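{- The only solutions of the equation $2^y-1=3^r(2^{x+1}+1)^w$ in integers $x\ge3$, $y\ge1$, $w\ge0$ and $r\in\mathbb{Z}$ arbitrary are $(x,y,w,r)\in\{(x,1,0,0),(x,2,0,1)\}$ (with $x\ge3$ arbitrary). -}

module Defs where

open import Data.Nat using (ℕ; suc; _+_; _*_; _∸_; _^_)
open import Data.Integer using (ℤ; +_; -[1+_])
open import Relation.Binary.PropositionalEquality using (_≡_)

-- For r ≥ 0 it is an equation in ℕ; for r = -(n+1) < 0 the factor 3^r = 1/3^(n+1)
-- is cleared: (2^y - 1) * 3^(n+1) = (2^(x+1) + 1)^w.
-- (Truncated subtraction 2^y ∸ 1 is exact since 2^y ≥ 1.)
Equation : ℕ → ℕ → ℕ → ℤ → Set
Equation x y w (+ r)      = 2 ^ y ∸ 1 ≡ 3 ^ r * (2 ^ (x + 1) + 1) ^ w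
Equation x y w -[1+ n ]   = (2 ^ y ∸ 1) * 3 ^ suc n ≡ (2 ^ (x + 1) + 1) ^ w

{-# OPTIONS --safe #-}
-- Put N = 2^(x+1) + 1, so N ≡ 1 (mod 16). For r ≥ 0 and w ≥ 1 the right-hand side
-- exceeds 8, forcing 16 ∣ 2^y, whereas 3^r N^w + 1 ≡ 3^r + 1 ∈ {2, 4, 10, 12} (mod 16);
-- hence w = 0 and 2^y = 3^r + 1, which for r ≥ 2 fails modulo 63. For r < 0 the equation
-- reads (2^y - 1) 3^k = N^w with k ≥ 1: if y ≥ 3 it fails modulo 8, and if y ≤ 2 it makes
-- N^w a positive power of 3, so N itself is a power of 3, which fails modulo 80.
module Submission where

open import Defs
open import Data.Nat
  using (ℕ; zero; suc; _+_; _*_; _∸_; _^_; _≤_; _<_; _≥_; _≤′_; ≤′-refl; ≤′-step; z≤n; s≤s; z<s; s<s;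
         NonZero; >-nonZero)
open import Data.Nat.Properties
open import Data.Nat.DivMod using (_%_; %-distribˡ-+; %-distribˡ-*)
open import Data.Nat.Divisibility using (_∣_; _∤_; divides; _∣?_; ∣1⇒≡1; *-cancelˡ-∣)
open import Data.Nat.Coprimality using (Coprime; coprime-divisor)
open import Data.Nat.Primality using (Prime; prime?; prime⇒irreducible; prime⇒nonZero)
open import Data.Integer using (ℤ; +_; -[1+_])
open import Data.List using (List; []; _∷_; [_])
open import Data.List.Relation.Unary.All using (All; all?; lookup)
open import Data.List.Relation.Unary.Any using (here)
open import Data.List.Membership.Propositional using (_∈_)
open import Data.List.Membership.DecPropositional _≟_ using (_∈?_; _∉?_)
open import Data.Product using (_×_; _,_; ∃-syntax; ∄-syntax)
open import Data.Sum using (_⊎_; inj₁; inj₂)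
open import Data.Empty using (⊥-elim)
open import Relation.Nullary using (Dec; yes; no; contradiction)
open import Relation.Nullary.Decidable using (True; toWitness; from-yes)
open import Relation.Binary using (tri<; tri≈; tri>)
open import Relation.Binary.PropositionalEquality
  using (_≡_; _≢_; refl; sym; trans; cong; subst; module ≡-Reasoning)

infix 4 _mod_∈_

-- A record rather than the bare type a % M ∈ S, so that a can be inferred from it
-- (_%_ is not injective).
record _mod_∈_ (a M : ℕ) (S : List ℕ) : Set where
  constructor mod∈
  field
    .{{nonZero}} : NonZero M
    residue∈     : a % M ∈ S

module Residues (M : ℕ) .{{M≢0 : NonZero M}} where

  -- At a concrete modulus and concrete residue lists, the implicit True arguments below
  -- are discharged by evaluating these tables.
  MapsInto : (ℕ → ℕ → ℕ) → List ℕ → List ℕ → List ℕ → Set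
  MapsInto _∙_ A B C = All (λ a → All (λ b → (a ∙ b) % M ∈ C) B) A

  mapsInto? : ∀ _∙_ A B C → Dec (MapsInto _∙_ A B C)
  mapsInto? _∙_ A B C = all? (λ a → all? (λ b → (a ∙ b) % M ∈? C) B) A

  private
    variable
      A B C S : List ℕ
      a b k : ℕ

    ∙-∈ : ∀ {_∙_} → (∀ a b → (a ∙ b) % M ≡ ((a % M) ∙ (b % M)) % M) →
          MapsInto _∙_ A B C → a mod M ∈ A → b mod M ∈ B → (a ∙ b) mod M ∈ C
    ∙-∈ {a = a} {b = b} distrib table (mod∈ a∈A) (mod∈ b∈B) =
      mod∈ {{M≢0}} (subst (_∈ _) (sym (distrib a b)) (lookup (lookup table a∈A) b∈B))

  residue : ∀ a → a mod M ∈ [ a % M ]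
  residue a = mod∈ (here refl)

  +-∈ : {table : True (mapsInto? _+_ A B C)} →
        a mod M ∈ A → b mod M ∈ B → a + b mod M ∈ C
  +-∈ {table = table} = ∙-∈ (λ a b → %-distribˡ-+ a b M) (toWitness table)

  *-∈ : {table : True (mapsInto? _*_ A B C)} →
        a mod M ∈ A → b mod M ∈ B → a * b mod M ∈ C
  *-∈ {table = table} = ∙-∈ (λ a b → %-distribˡ-* a b M) (toWitness table)

  ^-∈ : ∀ n {table : True (mapsInto? _*_ A S S)} →
        a mod M ∈ A → k ≤ n → a ^ k mod M ∈ S → a ^ n mod M ∈ S
  ^-∈ {A} {S} {a} {k} _ {table = table} a∈A k≤n a^k∈S = go (≤⇒≤′ k≤n)
    where
    go : ∀ {n} → k ≤′ n → a ^ n mod M ∈ S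
    go ≤′-refl        = a^k∈S
    go (≤′-step k≤′n) = *-∈ {table = table} a∈A (go k≤′n)

  disjoint-residues⇒≢ : {disjoint : True (all? (_∉? B) A)} →
                        a mod M ∈ A → b mod M ∈ B → a ≢ b
  disjoint-residues⇒≢ {disjoint = disjoint} (mod∈ a∈A) (mod∈ b∈B) refl =
    lookup (toWitness disjoint) a∈A b∈B

open Residues

^-injectiveʳ : ∀ {m a b} → 1 < m → m ^ a ≡ m ^ b → a ≡ b
^-injectiveʳ {m} {a} {b} 1<m m^a≡m^b with <-cmp a b
... | tri< a<b _ _ = contradiction m^a≡m^b (<⇒≢ (^-monoʳ-< m 1<m a<b))
... | tri≈ _ a≡b _ = a≡b
... | tri> _ _ b<a = contradiction m^a≡m^b (>⇒≢ (^-monoʳ-< m 1<m b<a))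

∤⇒coprime : ∀ {p d} → Prime p → p ∤ d → Coprime d p
∤⇒coprime pr p∤d (i∣d , i∣p) with prime⇒irreducible pr i∣p
... | inj₁ i≡1 = i≡1
... | inj₂ refl = contradiction i∣d p∤d

∣p^k⇒≡p^j : ∀ {p d} k → Prime p → d ∣ p ^ k → ∃[ j ] d ≡ p ^ j
∣p^k⇒≡p^j zero _ d∣1 = 0 , ∣1⇒≡1 d∣1
∣p^k⇒≡p^j {p} {d} (suc k) pr d∣p^[1+k] with p ∣? d
... | no p∤d = ∣p^k⇒≡p^j k pr (coprime-divisor (∤⇒coprime pr p∤d) d∣p^[1+k])
... | yes (divides q refl) =
  let j , q≡p^j = ∣p^k⇒≡p^j k pr q∣p^k in suc j , trans (*-comm q p) (cong (p *_) q≡p^j)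
  where
  q∣p^k : q ∣ p ^ k
  q∣p^k = *-cancelˡ-∣ p {{prime⇒nonZero pr}}
            (subst (_∣ p ^ suc k) (*-comm q p) d∣p^[1+k])

2^n∸1≡m⇒2^n≡1+m : ∀ n {m} → 2 ^ n ∸ 1 ≡ m → 2 ^ n ≡ 1 + m
2^n∸1≡m⇒2^n≡1+m n refl = sym (m+[n∸m]≡n (m^n>0 2 n))

2^m≡1+3^n⇒m≡1∧n≡0∨m≡2∧n≡1 : ∀ m n → 2 ^ m ≡ 1 + 3 ^ n →
                            (m ≡ 1 × n ≡ 0) ⊎ (m ≡ 2 × n ≡ 1)
2^m≡1+3^n⇒m≡1∧n≡0∨m≡2∧n≡1 m zero       eq = inj₁ (^-injectiveʳ (s<s z<s) eq , refl)
2^m≡1+3^n⇒m≡1∧n≡0∨m≡2∧n≡1 m (suc zero) eq = inj₂ (^-injectiveʳ (s<s z<s) eq , refl)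
2^m≡1+3^n⇒m≡1∧n≡0∨m≡2∧n≡1 m (suc (suc n)) eq =
  ⊥-elim (disjoint-residues⇒≢ 63 2^m%63 1+3^[2+n]%63 eq)
  where
  2^m%63 : 2 ^ m mod 63 ∈ 1 ∷ 2 ∷ 4 ∷ 8 ∷ 16 ∷ 32 ∷ []
  2^m%63 = ^-∈ 63 m (residue 63 2) z≤n (mod∈ (here refl))
  3^[2+n]%63 : 3 ^ (2 + n) mod 63 ∈ 9 ∷ 27 ∷ 18 ∷ 54 ∷ 36 ∷ 45 ∷ []
  3^[2+n]%63 = ^-∈ 63 (2 + n) (residue 63 3) (m≤m+n 2 n) (mod∈ (here refl))
  1+3^[2+n]%63 : 1 + 3 ^ (2 + n) mod 63 ∈ 10 ∷ 28 ∷ 19 ∷ 55 ∷ 37 ∷ 46 ∷ []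
  1+3^[2+n]%63 = +-∈ 63 (residue 63 1) 3^[2+n]%63

2^y≢1+3^r*N^[1+w] : ∀ {N} → N mod 16 ∈ [ 1 ] → 7 < N →
                    ∀ y r w → 2 ^ y ≢ 1 + 3 ^ r * N ^ suc w
2^y≢1+3^r*N^[1+w] {N} N%16 7<N y r w eq = disjoint-residues⇒≢ 16 2^y%16 1+3^r*N^[1+w]%16 eq
  where
  instance
    N≢0 : NonZero N
    N≢0 = >-nonZero (<-trans z<s 7<N)

  N≤3^r*N^[1+w] : N ≤ 3 ^ r * N ^ suc w
  N≤3^r*N^[1+w] =
    ≤-trans (m≤m*n N (N ^ w) {{m^n≢0 N w}}) (m≤n*m (N ^ suc w) (3 ^ r) {{m^n≢0 3 r}})

  8<2^y : 8 < 2 ^ y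
  8<2^y = subst (8 <_) (sym eq) (s≤s (≤-trans 7<N N≤3^r*N^[1+w]))

  4≤y : 4 ≤ y
  4≤y = ≰⇒> λ y≤3 → <⇒≱ 8<2^y (^-monoʳ-≤ 2 y≤3)

  2^y%16 : 2 ^ y mod 16 ∈ [ 0 ]
  2^y%16 = ^-∈ 16 y (residue 16 2) 4≤y (mod∈ (here refl))
  3^r%16 : 3 ^ r mod 16 ∈ 1 ∷ 3 ∷ 9 ∷ 11 ∷ []
  3^r%16 = ^-∈ 16 r (residue 16 3) z≤n (mod∈ (here refl))
  N^[1+w]%16 : N ^ suc w mod 16 ∈ [ 1 ]
  N^[1+w]%16 = ^-∈ 16 (suc w) N%16 z≤n (mod∈ (here refl))
  3^r*N^[1+w]%16 : 3 ^ r * N ^ suc w mod 16 ∈ 1 ∷ 3 ∷ 9 ∷ 11 ∷ []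
  3^r*N^[1+w]%16 = *-∈ 16 3^r%16 N^[1+w]%16
  1+3^r*N^[1+w]%16 : 1 + 3 ^ r * N ^ suc w mod 16 ∈ 2 ∷ 4 ∷ 10 ∷ 12 ∷ []
  1+3^r*N^[1+w]%16 = +-∈ 16 (residue 16 1) 3^r*N^[1+w]%16

3^[1+j]≢N^w : ∀ {N} → ∄[ i ] N ≡ 3 ^ i → ∀ j w → 3 ^ suc j ≢ N ^ w
3^[1+j]≢N^w _ j zero eq with m^n≡1⇒n≡0∨m≡1 3 (suc j) eq
... | inj₁ ()
... | inj₂ ()
3^[1+j]≢N^w {N} N≢3^i j (suc w) eq =
  N≢3^i (∣p^k⇒≡p^j (suc j) (from-yes (prime? 3)) N∣3^[1+j])
  where
  N∣3^[1+j] : N ∣ 3 ^ suc j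
  N∣3^[1+j] = divides (N ^ w) (trans eq (*-comm N (N ^ w)))

[2^y∸1]*3^[1+k]≢N^w : ∀ {N} → N mod 8 ∈ [ 1 ] → ∄[ i ] N ≡ 3 ^ i →
                      ∀ y k w → 1 ≤ y → (2 ^ y ∸ 1) * 3 ^ suc k ≢ N ^ w
[2^y∸1]*3^[1+k]≢N^w _ N≢3^i 1 k w _ eq =
  3^[1+j]≢N^w N≢3^i k w (trans (sym (*-identityˡ (3 ^ suc k))) eq)
[2^y∸1]*3^[1+k]≢N^w _ N≢3^i 2 k w _ eq =
  3^[1+j]≢N^w N≢3^i (suc k) w eq
[2^y∸1]*3^[1+k]≢N^w {N} N%8 _ y@(suc (suc (suc _))) k w _ eq =
  disjoint-residues⇒≢ 8 2^y*3^[1+k]%8 3^[1+k]+N^w%8 2^y*3^[1+k]≡3^[1+k]+N^w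
  where
  open ≡-Reasoning
  2^y*3^[1+k]≡3^[1+k]+N^w : 2 ^ y * 3 ^ suc k ≡ 3 ^ suc k + N ^ w
  2^y*3^[1+k]≡3^[1+k]+N^w = begin
    2 ^ y * 3 ^ suc k             ≡⟨ cong (_* 3 ^ suc k) (2^n∸1≡m⇒2^n≡1+m y refl) ⟩
    (1 + (2 ^ y ∸ 1)) * 3 ^ suc k ≡⟨ cong (_+_ (3 ^ suc k)) eq ⟩
    3 ^ suc k + N ^ w             ∎

  2^y%8 : 2 ^ y mod 8 ∈ [ 0 ]
  2^y%8 = ^-∈ 8 y (residue 8 2) (s≤s (s≤s (s≤s z≤n))) (mod∈ (here refl))
  3^[1+k]%8 : 3 ^ suc k mod 8 ∈ 1 ∷ 3 ∷ []
  3^[1+k]%8 = ^-∈ 8 (suc k) (residue 8 3) z≤n (mod∈ (here refl))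
  N^w%8 : N ^ w mod 8 ∈ [ 1 ]
  N^w%8 = ^-∈ 8 w N%8 z≤n (mod∈ (here refl))
  2^y*3^[1+k]%8 : 2 ^ y * 3 ^ suc k mod 8 ∈ [ 0 ]
  2^y*3^[1+k]%8 = *-∈ 8 2^y%8 3^[1+k]%8
  3^[1+k]+N^w%8 : 3 ^ suc k + N ^ w mod 8 ∈ 2 ∷ 4 ∷ []
  3^[1+k]+N^w%8 = +-∈ 8 3^[1+k]%8 N^w%8

module _ {x : ℕ} (x≥3 : x ≥ 3) where

  private
    4≤x+1 : 4 ≤ x + 1
    4≤x+1 = +-monoˡ-≤ 1 x≥3

  2^[x+1]+1%16 : 2 ^ (x + 1) + 1 mod 16 ∈ [ 1 ]
  2^[x+1]+1%16 = +-∈ 16 2^[x+1]%16 (residue 16 1)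
    where
    2^[x+1]%16 : 2 ^ (x + 1) mod 16 ∈ [ 0 ]
    2^[x+1]%16 = ^-∈ 16 (x + 1) (residue 16 2) 4≤x+1 (mod∈ (here refl))

  2^[x+1]+1%8 : 2 ^ (x + 1) + 1 mod 8 ∈ [ 1 ]
  2^[x+1]+1%8 = +-∈ 8 2^[x+1]%8 (residue 8 1)
    where
    2^[x+1]%8 : 2 ^ (x + 1) mod 8 ∈ [ 0 ]
    2^[x+1]%8 = ^-∈ 8 (x + 1) (residue 8 2) 4≤x+1 (mod∈ (here refl))

  7<2^[x+1]+1 : 7 < 2 ^ (x + 1) + 1
  7<2^[x+1]+1 = ≤-trans (m≤m+n 8 8) (≤-trans (^-monoʳ-≤ 2 4≤x+1) (m≤m+n _ 1))

  2^[x+1]+1≢3^i : ∄[ i ] 2 ^ (x + 1) + 1 ≡ 3 ^ i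
  2^[x+1]+1≢3^i (i , eq) = disjoint-residues⇒≢ 80 2^[x+1]+1%80 3^i%80 eq
    where
    2^[x+1]%80 : 2 ^ (x + 1) mod 80 ∈ 16 ∷ 32 ∷ 64 ∷ 48 ∷ []
    2^[x+1]%80 = ^-∈ 80 (x + 1) (residue 80 2) 4≤x+1 (mod∈ (here refl))
    2^[x+1]+1%80 : 2 ^ (x + 1) + 1 mod 80 ∈ 17 ∷ 33 ∷ 65 ∷ 49 ∷ []
    2^[x+1]+1%80 = +-∈ 80 2^[x+1]%80 (residue 80 1)
    3^i%80 : 3 ^ i mod 80 ∈ 1 ∷ 3 ∷ 9 ∷ 27 ∷ []
    3^i%80 = ^-∈ 80 i (residue 80 3) z≤n (mod∈ (here refl))

lemma1 : (x y w : ℕ) (r : ℤ) → x ≥ 3 → y ≥ 1 → Equation x y w r →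
    (y ≡ 1 × w ≡ 0 × r ≡ + 0) ⊎ (y ≡ 2 × w ≡ 0 × r ≡ + 1)
lemma1 x y zero (+ r) _ _ eq
  with 2^m≡1+3^n⇒m≡1∧n≡0∨m≡2∧n≡1 y r
         (2^n∸1≡m⇒2^n≡1+m y (trans eq (*-identityʳ (3 ^ r))))
... | inj₁ (refl , refl) = inj₁ (refl , refl , refl)
... | inj₂ (refl , refl) = inj₂ (refl , refl , refl)
lemma1 x y (suc w) (+ r) x≥3 _ eq =
  ⊥-elim (2^y≢1+3^r*N^[1+w] (2^[x+1]+1%16 x≥3) (7<2^[x+1]+1 x≥3) y r w
           (2^n∸1≡m⇒2^n≡1+m y eq))
lemma1 x y w -[1+ k ] x≥3 1≤y eq =
  ⊥-elim ([2^y∸1]*3^[1+k]≢N^w (2^[x+1]+1%8 x≥3) (2^[x+1]+1≢3^i x≥3) y k w 1≤y eq)
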